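{- In AML$^{S5}$, for all terms $B,C$, the formula $C\rightarrow\square B^c \Rightarrow B\rightarrow\square C^c$ is derivable; i.e. $B\rightarrow\square C^c$ is derivable from the hypothesis $C\rightarrow\square B^c$.
   Context: Aristotelic Modal Logic (AML). Fix a countable set $T$ of atomic terms. Terms: every atomic term is a term; if $A$ is a term then $A^c$, $\square A$ and $\sqcup A$ are terms. Atomic formulas: $A\rightarrow B$ and $A\rightsquigarrow B$; formulas built with $\&$ and $\Rightarrow$. Abbreviations: $\lozenge A := (\square(A^c))^c$, $\ominus A := (\sqcup A)^c$. Rules of AML (natural deduction): MP, $\Rightarrow$I (discharging a hypothesis), $\&$I, $\&$E; cEx: replace any number of occurrences of a subterm $C^{cc}$ by $C$ or of $C$ by $C^{cc}$; $\sqcup$Ex: replace occurrences of $\sqcup C^c$ by $\sqcup C$ or vice versa; $\rightarrow$T: $A\rightarrow B$, $B\rightarrow C$ / $A\rightarrow C$; $\rightsquigarrow$C: $A\rightsquigarrow B$ / $B\rightsquigarrow A$; $\rightsquigarrow$I: $A\rightsquigarrow B$ / $A\rightsquigarrow A$; $\rightsquigarrow$T: $A\rightsquigarrow B$, $B\rightarrow C$ / $A\rightsquigarrow C$; cC: $A\rightarrow B^c$ / $B\rightarrow A^c$; K: $A\rightarrow B$ / $\square A\rightarrow\square B$ (no restriction on hypotheses); $\sqcup$I: $\square A\rightarrow B$, $\square A^c\rightarrow B$ / $\sqcup A\rightarrow B$. Axioms: $\square A\rightarrow\sqcup A$, $\square A\rightarrow A$, $\square A\rightarrow\square\square A$. AML$^{S5}$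 is AML together with the axiom $\lozenge A\rightarrow\square\lozenge A$ for every term $A$. -}

module Defs where

open import Data.Nat using (ℕ)
open import Data.List using (List; _∷_)
open import Data.List.Membership.Propositional using (_∈_)

data Term : Set where
  atom : ℕ → Term
  _ᶜ   : Term → Term
  □_   : Term → Term
  ⊔_   : Term → Term

infixl 30 _ᶜ
infixr 25 □_ ⊔_

◇_ : Term → Term
◇ A = (□ (A ᶜ)) ᶜ

⊖_ : Term → Term
⊖ A = (⊔ A) ᶜ

infixr 25 ◇_ ⊖_

data Formula : Set where
  _⟶_ : Term → Term → Formula
  _⇝_ : Term → Term → Formula
  _&_ : Formula → Formula → Formula
  _⇒_ : Formula → Formula → Formula

infix 15 _⟶_ _⇝_
infixr 12 _&_
infixr 10 _⇒_

-- Replacement relation on terms for cEx and ⊔Ex: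
-- T ≈ₜ T' iff T' arises from T by replacing any number of (non-overlapping)
-- occurrences of subterms C^cc by C or C by C^cc, or ⊔ C^c by ⊔ C or vice versa.
data _≈ₜ_ : Term → Term → Set where
  ≈-refl  : ∀ {A} → A ≈ₜ A
  ≈-cc→   : ∀ {C C'} → C ≈ₜ C' → (C ᶜ ᶜ) ≈ₜ C'
  ≈-→cc   : ∀ {C C'} → C ≈ₜ C' → C ≈ₜ (C' ᶜ ᶜ)
  ≈-⊔c→   : ∀ {C C'} → C ≈ₜ C' → (⊔ (C ᶜ)) ≈ₜ (⊔ C')
  ≈-→⊔c   : ∀ {C C'} → C ≈ₜ C' → (⊔ C) ≈ₜ (⊔ (C' ᶜ))
  ≈-ᶜ     : ∀ {A A'} → A ≈ₜ A' → (A ᶜ) ≈ₜ (A' ᶜ)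
  ≈-□     : ∀ {A A'} → A ≈ₜ A' → (□ A) ≈ₜ (□ A')
  ≈-⊔     : ∀ {A A'} → A ≈ₜ A' → (⊔ A) ≈ₜ (⊔ A')

data _≈f_ : Formula → Formula → Set where
  ≈-⟶ : ∀ {A A' B B'} → A ≈ₜ A' → B ≈ₜ B' → (A ⟶ B) ≈f (A' ⟶ B')
  ≈-⇝ : ∀ {A A' B B'} → A ≈ₜ A' → B ≈ₜ B' → (A ⇝ B) ≈f (A' ⇝ B')
  ≈-& : ∀ {φ φ' ψ ψ'} → φ ≈f φ' → ψ ≈f ψ' → (φ & ψ) ≈f (φ' & ψ')
  ≈-⇒ : ∀ {φ φ' ψ ψ'} → φ ≈f φ' → ψ ≈f ψ' → (φ ⇒ ψ) ≈f (φ' ⇒ ψ')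

data _⊢_ (Γ : List Formula) : Formula → Set where
  hyp   : ∀ {φ} → φ ∈ Γ → Γ ⊢ φ
  mp    : ∀ {φ ψ} → Γ ⊢ (φ ⇒ ψ) → Γ ⊢ φ → Γ ⊢ ψ
  ⇒I    : ∀ {φ ψ} → (φ ∷ Γ) ⊢ ψ → Γ ⊢ (φ ⇒ ψ)
  &I    : ∀ {φ ψ} → Γ ⊢ φ → Γ ⊢ ψ → Γ ⊢ (φ & ψ)
  &E₁   : ∀ {φ ψ} → Γ ⊢ (φ & ψ) → Γ ⊢ φ
  &E₂   : ∀ {φ ψ} → Γ ⊢ (φ & ψ) → Γ ⊢ ψ
  ex    : ∀ {φ φ'} → φ ≈f φ' → Γ ⊢ φ → Γ ⊢ φ'          -- cEx and ⊔Ex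
  ⟶T    : ∀ {A B C} → Γ ⊢ (A ⟶ B) → Γ ⊢ (B ⟶ C) → Γ ⊢ (A ⟶ C)
  ⇝C    : ∀ {A B} → Γ ⊢ (A ⇝ B) → Γ ⊢ (B ⇝ A)
  ⇝I    : ∀ {A B} → Γ ⊢ (A ⇝ B) → Γ ⊢ (A ⇝ A)
  ⇝T    : ∀ {A B C} → Γ ⊢ (A ⇝ B) → Γ ⊢ (B ⟶ C) → Γ ⊢ (A ⇝ C)
  cC    : ∀ {A B} → Γ ⊢ (A ⟶ B ᶜ) → Γ ⊢ (B ⟶ A ᶜ)
  K     : ∀ {A B} → Γ ⊢ (A ⟶ B) → Γ ⊢ (□ A ⟶ □ B)
  ⊔I    : ∀ {A B} → Γ ⊢ (□ A ⟶ B) → Γ ⊢ (□ (A ᶜ) ⟶ B) → Γ ⊢ (⊔ A ⟶ B)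
  ax-⊔  : ∀ {A} → Γ ⊢ (□ A ⟶ ⊔ A)
  ax-T  : ∀ {A} → Γ ⊢ (□ A ⟶ A)
  ax-4  : ∀ {A} → Γ ⊢ (□ A ⟶ □ □ A)
  ax-5  : ∀ {A} → Γ ⊢ (◇ A ⟶ □ ◇ A)

module Submission where

open import Defs
open import Data.List using (List; []; _∷_)
open import Data.List.Relation.Unary.Any using (here)
open import Relation.Binary.PropositionalEquality using (refl)

-- B ⟶ ◇ B ⟶ □ ◇ B by S5, and □ ◇ B ⟶ □ (C ᶜ) by K applied to the
-- contraposition ◇ B ⟶ C ᶜ of the hypothesis (◇ B is (□ (B ᶜ)) ᶜ).

⟶-◇ : ∀ {Γ} (B : Term) → Γ ⊢ (B ⟶ ◇ B)
⟶-◇ B = cC (ax-T {A = B ᶜ})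

◇-contra : ∀ {Γ} {B C : Term} → Γ ⊢ (C ⟶ □ (B ᶜ)) → Γ ⊢ (◇ B ⟶ C ᶜ)
◇-contra C⟶□Bᶜ = cC (ex (≈-⟶ ≈-refl (≈-→cc ≈-refl)) C⟶□Bᶜ)

lemma2p11 : ∀ (B C : Term) → ((C ⟶ □ (B ᶜ)) ∷ []) ⊢ (B ⟶ □ (C ᶜ))
lemma2p11 B C = ⟶T (⟶T (⟶-◇ B) ax-5) (K (◇-contra (hyp (here refl))))
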